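{- Let $D$ be a digraph with at least two vertices and $s\in V(D)$ such that every vertex of $D$ is reachable from $s$, and let $B_s$ be the diblock of $s$ in $D$. Let $T$ be an out-tree in $D$ whose root $r$ lies in $B_s$ and which has $\ell$ leaves. Then $D$ contains an out-tree rooted at $s$ with at least $(\ell-1)/2$ leaves.
   Context: An out-tree is an oriented tree with exactly one vertex of in-degree zero (its root); its leaves are its vertices of out-degree zero. For a digraph $H$ and $r\in V(H)$ such that every vertex of $H$ is reachable from $r$, a vertex $v$ is bi-reachable from $r$ if there exist two internally vertex-disjoint directed paths from $r$ to $v$; the diblock $B_r$ of $r$ in $H$ is the set of all vertices bi-reachable from $r$ together with $r$ and all out-neighbours of $r$. -}

module Defs where

open import Data.Nat using (ℕ; zero; suc; _+_; _*_; _∸_; _≤_)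
open import Data.Fin using (Fin)
open import Data.Bool using (Bool; true; false; not; _∧_)
open import Data.List using (List; []; _∷_; length; filterᵇ)
open import Data.Bool.ListAction using (any)
open import Data.List.Relation.Unary.Unique.Propositional using (Unique)
open import Data.List.Membership.Propositional using (_∈_)
open import Data.List.Base using (allFin)
open import Data.Product using (Σ; ∃; _×_; _,_)
open import Data.Sum using (_⊎_)
open import Relation.Binary.PropositionalEquality using (_≡_; _≢_)

record Digraph : Set where
  field
    n        : ℕ
    adj      : Fin n → Fin n → Bool
    loopless : ∀ v → adj v v ≡ false
open Digraph public

data Walk {m : ℕ} (E : Fin m → Fin m → Bool) : Fin m → Fin m → Set where
  []  : ∀ {u} → Walk E u u
  _∷_ : ∀ {u w v} → E u w ≡ true → Walk E w v → Walk E u v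

verts : ∀ {m} {E : Fin m → Fin m → Bool} {u v} → Walk E u v → List (Fin m)
verts {u = u} []         = u ∷ []
verts {u = u} (_ ∷ p)    = u ∷ verts p

IsPath : ∀ {m} {E : Fin m → Fin m → Bool} {u v} → Walk E u v → Set
IsPath p = Unique (verts p)

Reachable : ∀ {m} (E : Fin m → Fin m → Bool) → Fin m → Fin m → Set
Reachable E u v = Walk E u v

InternallyDisjoint : ∀ {m} {E : Fin m → Fin m → Bool} {u v} →
  Walk E u v → Walk E u v → Set
InternallyDisjoint {u = u} {v = v} p q =
  ∀ x → x ∈ verts p → x ∈ verts q → (x ≡ u) ⊎ (x ≡ v)

BiReachable : (D : Digraph) → Fin (n D) → Fin (n D) → Set
BiReachable D r v =
  Σ (Walk (adj D) r v) λ p → Σ (Walk (adj D) r v) λ q →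
    IsPath p × IsPath q × InternallyDisjoint p q

InDiblock : (D : Digraph) → Fin (n D) → Fin (n D) → Set
InDiblock D r x = (x ≡ r) ⊎ ((adj D r x ≡ true) ⊎ BiReachable D r x)

record OutTree (D : Digraph) : Set where
  field
    inV      : Fin (n D) → Bool
    inA      : Fin (n D) → Fin (n D) → Bool
    root     : Fin (n D)
    arcs-in-D   : ∀ u v → inA u v ≡ true → adj D u v ≡ true
    arcs-in-V   : ∀ u v → inA u v ≡ true → (inV u ≡ true) × (inV v ≡ true)
    root-in-V   : inV root ≡ true
    root-indeg0 : ∀ u → inA u root ≡ false
    indeg1      : ∀ v → inV v ≡ true → v ≢ root →
                  Σ (Fin (n D)) λ u → (inA u v ≡ true) × (∀ u' → inA u' v ≡ true → u' ≡ u)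
    reach       : ∀ v → inV v ≡ true → Reachable inA root v
open OutTree public

isLeaf : {D : Digraph} → OutTree D → Fin (n D) → Bool
isLeaf {D} T v = inV T v ∧ not (any (inA T v) (allFin (n D)))

numLeaves : {D : Digraph} → OutTree D → ℕ
numLeaves {D} T = length (filterᵇ (isLeaf T) (allFin (n D)))

module Submission where

-- Proof by re-rooting.  Let T be an out-tree with root r ∈ B_s and ℓ leaves.
--
-- * If T has root w and D has an arc s → w, then adding the vertex s and the
--   arc s → w to T, and deleting the (at most one) arc of T entering s, gives
--   an out-tree rooted at s in which every leaf of T other than s is still a
--   leaf (module AddRoot).
-- * Iterating this backwards along a walk P from s to r gives an out-tree
--   rooted at s keeping every leaf of T that is not a non-final vertex of P
--   (rerootAlong).
-- * If r ≠ s, membership of r in B_s yields two s–r walks whose non-final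
--   vertices meet only in s: the arc s → r taken twice, or the two internally
--   disjoint paths (the end of a path is never one of its non-final vertices).
--   Each leaf of T other than s then survives in one of the two re-rooted
--   trees, so ℓ ≤ ℓ₁ + ℓ₂ + 1 (a counting argument), and the better of the two
--   trees has at least (ℓ - 1)/2 leaves (fromTwoWalks).  If r = s, T works.

open import Defs
open import Data.Nat using (ℕ; _+_; _≤_; _∸_; _*_; z≤n; s≤s)
open import Data.Nat.Properties
  using (≤-trans; ≤-reflexive; ≤-total; +-mono-≤; +-monoˡ-≤; +-monoʳ-≤;
         +-identityʳ; m∸n≤m; m≤m+n; ∸-monoˡ-≤; m+n∸n≡m)
open import Data.Nat.Tactic.RingSolver using (solve-∀)
open import Data.Fin using (Fin; _≟_)
open import Data.Bool using (Bool; true; false; not; _∧_; _∨_)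
open import Data.Bool.Properties using (∨-zeroʳ)
open import Data.Bool.ListAction using (any)
open import Data.List using (List; []; _∷_; length; filterᵇ; allFin)
open import Data.List.Relation.Unary.All using (All; []; _∷_)
open import Data.List.Relation.Unary.AllPairs using ([]; _∷_)
open import Data.List.Relation.Unary.Any using (here; there; any?)
open import Data.List.Relation.Unary.Unique.Propositional using (Unique)
open import Data.List.Relation.Unary.Unique.Propositional.Properties using (allFin⁺)
open import Data.List.Membership.Propositional using (_∈_)
open import Data.Product using (Σ; _×_; _,_; proj₁; proj₂)
open import Data.Sum using (_⊎_; inj₁; inj₂)
import Data.Sum as Sum
open import Data.Empty using (⊥-elim)
open import Function using (case_of_; id)
open import Relation.Nullary using (¬_; yes; no; does)
open import Relation.Nullary.Decidable using (dec-true; dec-false)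
open import Relation.Binary.PropositionalEquality
  using (_≡_; _≢_; refl; sym; trans; subst; cong; cong₂)

true≢false : true ≢ false
true≢false ()

∨-elim : ∀ {a b} → a ∨ b ≡ true → a ≡ true ⊎ b ≡ true
∨-elim {true}  _ = inj₁ refl
∨-elim {false} h = inj₂ h

∧-elim : ∀ {a b} → a ∧ b ≡ true → a ≡ true × b ≡ true
∧-elim {true} h = refl , h

not-elim : ∀ {a} → not a ≡ true → a ≡ false
not-elim {false} _ = refl

-- If f ⊆ g pointwise and g holds nowhere on xs, neither does f; this is how
-- "out-degree zero" transfers to a tree with fewer arcs at a vertex.
any-false-mono : ∀ {A : Set} (f g : A → Bool) → (∀ y → f y ≡ true → g y ≡ true) →
  ∀ xs → any g xs ≡ false → any f xs ≡ false
any-false-mono f g f⊆g []       _ = refl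
any-false-mono f g f⊆g (x ∷ xs) h with g x in gx
... | true  = ⊥-elim (true≢false h)
... | false with f x in fx
...   | true  = ⊥-elim (true≢false (trans (sym (f⊆g x fx)) gx))
...   | false = any-false-mono f g f⊆g xs h

_==_ : ∀ {m} → Fin m → Fin m → Bool
x == y = does (x ≟ y)

==⇒≡ : ∀ {m} {x y : Fin m} → x == y ≡ true → x ≡ y
==⇒≡ {x = x} {y} h with x ≟ y
... | yes x≡y = x≡y

==-refl : ∀ {m} (x : Fin m) → x == x ≡ true
==-refl x = dec-true (x ≟ x) refl

≢⇒==-false : ∀ {m} {x y : Fin m} → x ≢ y → x == y ≡ false
≢⇒==-false {x = x} {y} = dec-false (x ≟ y)

==-false⇒≢ : ∀ {m} {x y : Fin m} → x == y ≡ false → x ≢ y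
==-false⇒≢ {x = x} h refl = true≢false (trans (sym (==-refl x)) h)

count : ∀ {A : Set} → (A → Bool) → List A → ℕ
count f xs = length (filterᵇ f xs)

indicator : Bool → ℕ
indicator true  = 1
indicator false = 0

count-cons : ∀ {A : Set} (f : A → Bool) x xs →
  count f (x ∷ xs) ≡ indicator (f x) + count f xs
count-cons f x xs with f x
... | true  = refl
... | false = refl

regroup : ∀ a b c A B C → (a + A) + (b + B) + (c + C) ≡ (a + b + c) + (A + B + C)
regroup = solve-∀

count-cover : ∀ {A : Set} (f g h k : A → Bool) →
  (∀ x → f x ≡ true → g x ≡ true ⊎ h x ≡ true ⊎ k x ≡ true) →
  ∀ xs → count f xs ≤ count g xs + count h xs + count k xs
count-cover f g h k cover [] = z≤n
count-cover f g h k cover (x ∷ xs)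
  rewrite count-cons f x xs | count-cons g x xs | count-cons h x xs | count-cons k x xs
        | regroup (indicator (g x)) (indicator (h x)) (indicator (k x))
                  (count g xs) (count h xs) (count k xs)
  = +-mono-≤ (pointwise (cover x)) (count-cover f g h k cover xs)
  where
  pointwise : (f x ≡ true → g x ≡ true ⊎ h x ≡ true ⊎ k x ≡ true) →
    indicator (f x) ≤ indicator (g x) + indicator (h x) + indicator (k x)
  pointwise c with f x | g x | h x | k x
  ... | false | _     | _     | _    = z≤n
  ... | true  | true  | _     | _    = s≤s z≤n
  ... | true  | false | true  | _    = s≤s z≤n
  ... | true  | false | false | true = s≤s z≤n
  ... | true  | false | false | false with c refl
  ...   | inj₁ ()
  ...   | inj₂ (inj₁ ())
  ...   | inj₂ (inj₂ ())

count-absent : ∀ {m} {x : Fin m} ys → All (x ≢_) ys → count (_== x) ys ≡ 0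
count-absent []       []         = refl
count-absent {x = x} (y ∷ ys) (x≢y ∷ ps)
  rewrite count-cons (_== x) y ys | ≢⇒==-false (λ y≡x → x≢y (sym y≡x)) = count-absent ys ps

count-occurrences : ∀ {m} (s : Fin m) xs → Unique xs → count (_== s) xs ≤ 1
count-occurrences s [] _ = z≤n
count-occurrences s (x ∷ xs) (x∉xs ∷ unique) rewrite count-cons (_== s) x xs
  with x ≟ s
... | yes refl rewrite count-absent xs x∉xs = s≤s z≤n
... | no _ = count-occurrences s xs unique

initVerts : ∀ {m} {E : Fin m → Fin m → Bool} {u v} → Walk E u v → List (Fin m)
initVerts []              = []
initVerts {u = u} (_ ∷ p) = u ∷ initVerts p

end∈verts : ∀ {m} {E : Fin m → Fin m → Bool} {u v} (p : Walk E u v) → v ∈ verts p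
end∈verts []      = here refl
end∈verts (_ ∷ p) = there (end∈verts p)

initVerts⊆verts : ∀ {m} {E : Fin m → Fin m → Bool} {u v} (p : Walk E u v) {x} →
  x ∈ initVerts p → x ∈ verts p
initVerts⊆verts (_ ∷ p) (here x≡u) = here x≡u
initVerts⊆verts (_ ∷ p) (there x∈) = there (initVerts⊆verts p x∈)

end∉initVerts : ∀ {m} {E : Fin m → Fin m → Bool} {u v} (p : Walk E u v) →
  IsPath p → ¬ (v ∈ initVerts p)
end∉initVerts (_ ∷ p) (u∉p ∷ _)    (here v≡u) = distinct u∉p (end∈verts p) (sym v≡u)
  where
  distinct : ∀ {x y} {xs : List _} → All (x ≢_) xs → y ∈ xs → x ≢ y
  distinct (x≢z ∷ _)  (here refl) = x≢z
  distinct (_ ∷ ps)   (there y∈)  = distinct ps y∈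
end∉initVerts (_ ∷ p) (_ ∷ pathP) (there v∈) = end∉initVerts p pathP v∈

MeetOnlyAtStart : ∀ {m} {E : Fin m → Fin m → Bool} {s r} → Walk E s r → Walk E s r → Set
MeetOnlyAtStart {s = s} P Q = ∀ v → v ∈ initVerts P → v ∈ initVerts Q → v ≡ s

module AddRoot (D : Digraph) (T : OutTree D) (s : Fin (n D))
               (s→w : adj D s (root T) ≡ true) where

  w : Fin (n D)
  w = root T

  -- D is loopless, so the new root differs from the old one.
  s≢w : s ≢ w
  s≢w s≡w = true≢false (trans (sym s→w) (subst (λ z → adj D s z ≡ false) s≡w (loopless D s)))

  inV⁺ : Fin (n D) → Bool
  inV⁺ v = inV T v ∨ (v == s)

  inA⁺ : Fin (n D) → Fin (n D) → Bool
  inA⁺ x y = (not (y == s) ∧ inA T x y) ∨ ((x == s) ∧ (y == w))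

  inV⁺-T : ∀ {v} → inV T v ≡ true → inV⁺ v ≡ true
  inV⁺-T h rewrite h = refl

  inV⁺-s : inV⁺ s ≡ true
  inV⁺-s rewrite ==-refl s = ∨-zeroʳ _

  inV⁺-inv : ∀ {v} → inV⁺ v ≡ true → v ≢ s → inV T v ≡ true
  inV⁺-inv h v≢s with ∨-elim h
  ... | inj₁ inT = inT
  ... | inj₂ v=s = ⊥-elim (v≢s (==⇒≡ v=s))

  arc⁺-T : ∀ {x y} → inA T x y ≡ true → y ≢ s → inA⁺ x y ≡ true
  arc⁺-T a y≢s rewrite a | ≢⇒==-false y≢s = refl

  arc⁺-s : inA⁺ s w ≡ true
  arc⁺-s rewrite ==-refl s | ==-refl w = ∨-zeroʳ _

  arc⁺-inv : ∀ {x y} → inA⁺ x y ≡ true → (inA T x y ≡ true × y ≢ s) ⊎ (x ≡ s × y ≡ w)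
  arc⁺-inv h with ∨-elim h
  ... | inj₁ kept = let y≠s , a = ∧-elim kept in inj₁ (a , ==-false⇒≢ (not-elim y≠s))
  ... | inj₂ new  = let x=s , y=w = ∧-elim new in inj₂ (==⇒≡ x=s , ==⇒≡ y=w)

  arcs-in-D⁺ : ∀ x y → inA⁺ x y ≡ true → adj D x y ≡ true
  arcs-in-D⁺ x y h with arc⁺-inv h
  ... | inj₁ (a , _)        = arcs-in-D T x y a
  ... | inj₂ (refl , refl) = s→w

  arcs-in-V⁺ : ∀ x y → inA⁺ x y ≡ true → (inV⁺ x ≡ true) × (inV⁺ y ≡ true)
  arcs-in-V⁺ x y h with arc⁺-inv h
  ... | inj₁ (a , _)        = inV⁺-T (proj₁ (arcs-in-V T x y a)) , inV⁺-T (proj₂ (arcs-in-V T x y a))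
  ... | inj₂ (refl , refl) = inV⁺-s , inV⁺-T (root-in-V T)

  root-indeg0⁺ : ∀ x → inA⁺ x s ≡ false
  root-indeg0⁺ x with inA⁺ x s in h
  ... | false = refl
  ... | true with arc⁺-inv h
  ...   | inj₁ (_ , s≢s) = ⊥-elim (s≢s refl)
  ...   | inj₂ (_ , s≡w) = ⊥-elim (s≢w s≡w)

  UniqueParent⁺ : Fin (n D) → Set
  UniqueParent⁺ v = Σ (Fin (n D)) λ u → (inA⁺ u v ≡ true) × (∀ u' → inA⁺ u' v ≡ true → u' ≡ u)

  -- The old root w had no in-neighbour in T, so its only one is now s.
  parentOfW : UniqueParent⁺ w
  parentOfW = s , arc⁺-s , only-s
    where
    only-s : ∀ u' → inA⁺ u' w ≡ true → u' ≡ s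
    only-s u' h with arc⁺-inv h
    ... | inj₁ (a , _)    = ⊥-elim (true≢false (trans (sym a) (root-indeg0 T u')))
    ... | inj₂ (u'≡s , _) = u'≡s

  parentFromT : ∀ {v} → inV⁺ v ≡ true → v ≢ s → v ≢ w → UniqueParent⁺ v
  parentFromT {v} hv v≢s v≢w with indeg1 T v (inV⁺-inv hv v≢s) v≢w
  ... | u , a , unique = u , arc⁺-T a v≢s , unique⁺
    where
    unique⁺ : ∀ u' → inA⁺ u' v ≡ true → u' ≡ u
    unique⁺ u' h with arc⁺-inv h
    ... | inj₁ (a' , _)  = unique u' a'
    ... | inj₂ (_ , v≡w) = ⊥-elim (v≢w v≡w)

  indeg1⁺ : ∀ v → inV⁺ v ≡ true → v ≢ s → UniqueParent⁺ v
  indeg1⁺ v hv v≢s = case v ≟ w of λ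
    { (yes v≡w) → subst UniqueParent⁺ (sym v≡w) parentOfW
    ; (no v≢w)  → parentFromT hv v≢s v≢w }

  -- A walk in T either survives as a walk in the new tree or passes through
  -- s, in which case its tail is a walk from s.
  transportWalk : ∀ {a v} → Walk (inA T) a v → Walk inA⁺ a v ⊎ Walk inA⁺ s v
  transportWalk []                 = inj₁ []
  transportWalk (_∷_ {w = b} a p) with transportWalk p
  ... | inj₂ fromS = inj₂ fromS
  ... | inj₁ fromB with b ≟ s
  ...   | yes refl = inj₂ fromB
  ...   | no b≢s   = inj₁ (arc⁺-T a b≢s ∷ fromB)

  reach⁺ : ∀ v → inV⁺ v ≡ true → Walk inA⁺ s v
  reach⁺ v hv = case v ≟ s of λ
    { (yes v≡s) → subst (Walk inA⁺ s) (sym v≡s) []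
    ; (no v≢s)  → Sum.[ arc⁺-s ∷_ , id ] (transportWalk (reach T v (inV⁺-inv hv v≢s))) }

  tree : OutTree D
  tree = record
    { inV = inV⁺ ; inA = inA⁺ ; root = s
    ; arcs-in-D = arcs-in-D⁺ ; arcs-in-V = arcs-in-V⁺ ; root-in-V = inV⁺-s
    ; root-indeg0 = root-indeg0⁺ ; indeg1 = indeg1⁺ ; reach = reach⁺ }

  -- Away from s no arcs were added, so leaves of T other than s remain leaves.
  noNewArcs : ∀ {v} → v ≢ s → ∀ y → inA⁺ v y ≡ true → inA T v y ≡ true
  noNewArcs v≢s y h with arc⁺-inv h
  ... | inj₁ (a , _)   = a
  ... | inj₂ (v≡s , _) = ⊥-elim (v≢s v≡s)

  keepsLeaves : ∀ v → isLeaf T v ≡ true → v ≢ s → isLeaf tree v ≡ true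
  keepsLeaves v leaf v≢s =
    let inT , noOutArcs = ∧-elim leaf
    in cong₂ _∧_ (inV⁺-T inT)
                 (cong not (any-false-mono (inA⁺ v) (inA T v) (noNewArcs v≢s) (allFin (n D))
                                           (not-elim noOutArcs)))

rerootAlong : (D : Digraph) (T : OutTree D) {a : Fin (n D)} (P : Walk (adj D) a (root T)) →
  Σ (OutTree D) λ T′ → (root T′ ≡ a) ×
    (∀ v → isLeaf T v ≡ true → ¬ (v ∈ initVerts P) → isLeaf T′ v ≡ true)
rerootAlong D T [] = T , refl , λ v leaf _ → leaf
rerootAlong D T {a} (a→b ∷ Q) with rerootAlong D T Q
... | Tb , refl , keep =
  AddRoot.tree D Tb a a→b , refl ,
  λ v leaf v∉P → AddRoot.keepsLeaves D Tb a a→b v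
                   (keep v leaf (λ v∈Q → v∉P (there v∈Q))) (λ v≡a → v∉P (here v≡a))

sum≤twiceMax : ∀ a b → a + b ≤ 2 * a ⊎ a + b ≤ 2 * b
sum≤twiceMax a b with ≤-total a b
... | inj₁ a≤b = inj₂ (≤-trans (+-monoˡ-≤ b a≤b) (≤-reflexive (cong (b +_) (sym (+-identityʳ b)))))
... | inj₂ b≤a = inj₁ (≤-trans (+-monoʳ-≤ a b≤a) (≤-reflexive (cong (a +_) (sym (+-identityʳ a)))))

halfOfSum : ∀ l a b → l ≤ a + b + 1 → l ∸ 1 ≤ 2 * a ⊎ l ∸ 1 ≤ 2 * b
halfOfSum l a b h = Sum.map (≤-trans l∸1≤a+b) (≤-trans l∸1≤a+b) (sum≤twiceMax a b)
  where
  l∸1≤a+b : l ∸ 1 ≤ a + b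
  l∸1≤a+b = ≤-trans (∸-monoˡ-≤ 1 h) (≤-reflexive (m+n∸n≡m (a + b) 1))

-- Two s–root walks meeting only at s give an out-tree rooted at s with at
-- least (ℓ - 1)/2 leaves: every leaf other than s survives in one of the two
-- re-rooted trees, and s is counted at most once.
fromTwoWalks : (D : Digraph) (T : OutTree D) {s : Fin (n D)}
  (P Q : Walk (adj D) s (root T)) → MeetOnlyAtStart P Q →
  Σ (OutTree D) λ T′ → (root T′ ≡ s) × (numLeaves T ∸ 1 ≤ 2 * numLeaves T′)
fromTwoWalks D T {s} P Q meet
  with rerootAlong D T P | rerootAlong D T Q
... | T₁ , root₁ , keep₁ | T₂ , root₂ , keep₂
  with halfOfSum (numLeaves T) (numLeaves T₁) (numLeaves T₂) leafBound
  where
  survives : ∀ v → isLeaf T v ≡ true →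
    isLeaf T₁ v ≡ true ⊎ isLeaf T₂ v ≡ true ⊎ (v == s) ≡ true
  survives v leaf with any? (v ≟_) (initVerts P) | any? (v ≟_) (initVerts Q)
  ... | no v∉P  | _       = inj₁ (keep₁ v leaf v∉P)
  ... | yes _   | no v∉Q  = inj₂ (inj₁ (keep₂ v leaf v∉Q))
  ... | yes v∈P | yes v∈Q rewrite meet v v∈P v∈Q = inj₂ (inj₂ (==-refl s))
  leafBound : numLeaves T ≤ numLeaves T₁ + numLeaves T₂ + 1
  leafBound = ≤-trans (count-cover (isLeaf T) (isLeaf T₁) (isLeaf T₂) (_== s) survives allVerts)
                      (+-monoʳ-≤ (numLeaves T₁ + numLeaves T₂)
                                 (count-occurrences s allVerts (allFin⁺ (n D))))
    where allVerts = allFin (n D)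
... | inj₁ better₁ = T₁ , root₁ , better₁
... | inj₂ better₂ = T₂ , root₂ , better₂

diblockWalks : (D : Digraph) {s r : Fin (n D)} → InDiblock D s r →
  r ≡ s ⊎ Σ (Walk (adj D) s r) λ P → Σ (Walk (adj D) s r) λ Q → MeetOnlyAtStart P Q
diblockWalks D (inj₁ r≡s)        = inj₁ r≡s
diblockWalks D (inj₂ (inj₁ s→r)) = inj₂ (s→r ∷ [] , s→r ∷ [] , λ { v (here v≡s) _ → v≡s })
diblockWalks D (inj₂ (inj₂ (P , Q , pathP , _ , disjoint))) = inj₂ (P , Q , meet)
  where
  meet : MeetOnlyAtStart P Q
  meet v v∈P v∈Q with disjoint v (initVerts⊆verts P v∈P) (initVerts⊆verts Q v∈Q)
  ... | inj₁ v≡s = v≡s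
  ... | inj₂ v≡r = ⊥-elim (end∉initVerts P pathP (subst (_∈ initVerts P) v≡r v∈P))

lemma4 : (D : Digraph) → 2 ≤ n D → (s : Fin (n D)) →
    (∀ v → Reachable (adj D) s v) →
    (T : OutTree D) → InDiblock D s (root T) →
    Σ (OutTree D) λ T′ → (root T′ ≡ s) × (numLeaves T ∸ 1 ≤ 2 * numLeaves T′)
lemma4 D _ s _ T r∈Bs with diblockWalks D r∈Bs
... | inj₁ r≡s          = T , r≡s , ≤-trans (m∸n≤m (numLeaves T) 1) (m≤m+n (numLeaves T) _)
... | inj₂ (P , Q , meet) = fromTwoWalks D T P Q meet
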